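{- For every positive integer $n$, the equation $a^2+b^2+ab=7^n$ has at least one solution $(a,b)$ in positive integers such that $\gcd(a,7)=1$. -}

module Defs where

-- a² + ab + b² is the norm of a + bρ in the Eisenstein integers (ρ² = ρ − 1), and 7 is the norm
-- of 1 + 2ρ.  Multiplying a + bρ by 1 + 2ρ gives (a − 2b) + (2a + 3b)ρ; when a < 2b, multiplying
-- further by the unit 1 − ρ gives (3a + b) + (2b − a)ρ instead, so a solution for 7ⁿ with positive
-- coordinates yields one for 7ⁿ⁺¹.  The first coordinate stays prime to 7 because the step
-- preserves the invariant b ≡ 2a (mod 7), 7 ∤ a, which holds for 1² + 1·2 + 2² = 7.
module Submission where

open import Defs
open import Data.Nat using (ℕ; zero; suc; _+_; _*_; _^_; _≤_; _<_; z≤n; s≤s; NonZero; _<?_)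
open import Data.Nat.GCD using (gcd)
open import Data.Product using (_×_; ∃-syntax; _,_)
open import Data.Nat.Properties
  using (≤-trans; ≤-<-connex; m≤m+n; m≤n*m; +-suc; +-cancelʳ-≡; m≤n⇒∃[o]m+o≡n)
open import Data.Nat.Divisibility
  using (_∣_; _∤_; divides; _∣0; ∣-trans; m∣m*n; n∣m*n; ∣m∣n⇒∣m+n; ∣m+n∣m⇒∣n; >⇒∤)
open import Data.Nat.Coprimality using (Coprime; coprime-divisor; coprime⇒gcd≡1; prime⇒coprime)
open import Data.Nat.Primality using (Prime; prime?; prime⇒irreducible)
open import Data.Sum using (inj₁; inj₂)
open import Relation.Nullary using (contradiction)
open import Relation.Nullary.Decidable using (from-yes)
open import Relation.Binary.PropositionalEquality using (_≡_; refl; trans; cong; subst; module ≡-Reasoning)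
open import Data.Nat.Tactic.RingSolver using (solve-∀)

private
  variable
    n p : ℕ

∤⇒coprime : Prime p → p ∤ n → Coprime n p
∤⇒coprime pr p∤n (d∣n , d∣p) with prime⇒irreducible pr d∣p
... | inj₁ d≡1  = d≡1
... | inj₂ refl = contradiction d∣n p∤n

∣k*n⇒∣n : Prime p → ∀ k .{{_ : NonZero k}} → k < p → p ∣ k * n → p ∣ n
∣k*n⇒∣n pr k k<p = coprime-divisor (prime⇒coprime pr k<p)

prime[7] : Prime 7
prime[7] = from-yes (prime? 7)

∤⇒positive : p ∤ n → 1 ≤ n
∤⇒positive {p} {zero}  p∤0 = contradiction (p ∣0) p∤0
∤⇒positive {_} {suc _} _   = s≤s z≤n

Q : ℕ → ℕ → ℕ
Q a b = a * a + b * b + a * b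

-- Q (a − 2b) (2a + 3b) ≡ 7 * Q a b for a = 2b + d, with Q unfolded since the ring solver does not unfold it.
Q-step-≥ : ∀ b d → d * d + (7 * b + 2 * d) * (7 * b + 2 * d) + d * (7 * b + 2 * d)
                 ≡ 7 * ((2 * b + d) * (2 * b + d) + b * b + (2 * b + d) * b)
Q-step-≥ = solve-∀

-- Q (3a + b) (2b − a) ≡ 7 * Q a b, with both sides shifted so that no subtraction occurs.
Q-step-<′ : ∀ a b e → ((3 * a + b) * (3 * a + b) + e * e + (3 * a + b) * e) + 2 * b * (e + 2 * a + 3 * b)
                    ≡ 7 * (a * a + b * b + a * b) + (a + e) * (e + 2 * a + 3 * b)
Q-step-<′ = solve-∀

Q-step-< : ∀ a b e → a + e ≡ 2 * b → Q (3 * a + b) e ≡ 7 * Q a b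
Q-step-< a b e a+e≡2b = +-cancelʳ-≡ _ _ _ (begin
  Q (3 * a + b) e + 2 * b * s   ≡⟨ Q-step-<′ a b e ⟩
  7 * Q a b + (a + e) * s       ≡⟨ cong (λ x → 7 * Q a b + x * s) a+e≡2b ⟩
  7 * Q a b + 2 * b * s         ∎)
  where
  open ≡-Reasoning
  s = e + 2 * a + 3 * b

-- The invariant b ≡ 2a (mod 7) is written as 7 ∣ b + 5a.
record Solution (n : ℕ) : Set where
  constructor solution
  field
    a b   : ℕ
    1≤b   : 1 ≤ b
    Q≡7^n : Q a b ≡ 7 ^ n
    b≡2a  : 7 ∣ b + 5 * a
    7∤a   : 7 ∤ a

solution[1] : Solution 1
solution[1] = solution 1 2 (s≤s z≤n) refl (divides 1 refl) (>⇒∤ (s≤s (s≤s z≤n)))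

next-≥ : ∀ b d → 1 ≤ b → Q (2 * b + d) b ≡ 7 ^ n → 7 ∣ b + 5 * (2 * b + d) → 7 ∤ 2 * b + d →
         Solution (suc n)
next-≥ b d 1≤b Q≡7^n b≡2a 7∤a =
  solution d (7 * b + 2 * d) 1≤b′ (trans (Q-step-≥ b d) (cong (7 *_) Q≡7^n)) (divides (b + d) (b′+5d b d)) 7∤d
  where
  b′+5d : ∀ b d → (7 * b + 2 * d) + 5 * d ≡ (b + d) * 7
  b′+5d = solve-∀
  b+5a : ∀ b d → b + 5 * (2 * b + d) ≡ (7 * b + 5 * d) + 4 * b
  b+5a = solve-∀
  1≤b′ : 1 ≤ 7 * b + 2 * d
  1≤b′ = ≤-trans 1≤b (≤-trans (m≤n*m b 7) (m≤m+n (7 * b) (2 * d)))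
  7∤d : 7 ∤ d
  7∤d 7∣d = 7∤a (∣m∣n⇒∣m+n (∣-trans 7∣b (n∣m*n 2)) 7∣d)
    where
    7∣b : 7 ∣ b
    7∣b = ∣k*n⇒∣n prime[7] 4 (from-yes (4 <? 7))
            (∣m+n∣m⇒∣n (subst (7 ∣_) (b+5a b d) b≡2a) (∣m∣n⇒∣m+n (m∣m*n b) (∣-trans 7∣d (n∣m*n 5))))

next-< : ∀ a b e → a + suc e ≡ 2 * b → Q a b ≡ 7 ^ n → 7 ∣ b + 5 * a → 7 ∤ a → Solution (suc n)
next-< a b e a+1+e≡2b Q≡7^n b≡2a 7∤a =
  solution (3 * a + b) (suc e) (s≤s z≤n) (trans (Q-step-< a b (suc e) a+1+e≡2b) (cong (7 *_) Q≡7^n))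
           (divides (2 * a + b) (+-cancelʳ-≡ a _ _ b′+5a′+a)) 7∤a′
  where
  open ≡-Reasoning
  b′+5a′+a : (suc e + 5 * (3 * a + b)) + a ≡ (2 * a + b) * 7 + a
  b′+5a′+a = begin
    (suc e + 5 * (3 * a + b)) + a  ≡⟨ regroup a b (suc e) ⟩
    (a + suc e) + (15 * a + 5 * b) ≡⟨ cong (_+ (15 * a + 5 * b)) a+1+e≡2b ⟩
    2 * b + (15 * a + 5 * b)       ≡⟨ factor a b ⟩
    (2 * a + b) * 7 + a            ∎
    where
    regroup : ∀ a b e → (e + 5 * (3 * a + b)) + a ≡ (a + e) + (15 * a + 5 * b)
    regroup = solve-∀
    factor : ∀ a b → 2 * b + (15 * a + 5 * b) ≡ (2 * a + b) * 7 + a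
    factor = solve-∀
  b+5a : ∀ a b → b + 5 * a ≡ (3 * a + b) + 2 * a
  b+5a = solve-∀
  7∤a′ : 7 ∤ 3 * a + b
  7∤a′ 7∣a′ = 7∤a (∣k*n⇒∣n prime[7] 2 (from-yes (2 <? 7)) (∣m+n∣m⇒∣n (subst (7 ∣_) (b+5a a b) b≡2a) 7∣a′))

next : Solution n → Solution (suc n)
next (solution a b 1≤b Q≡7^n b≡2a 7∤a) with ≤-<-connex (2 * b) a
... | inj₁ 2b≤a with d , refl ← m≤n⇒∃[o]m+o≡n 2b≤a = next-≥ b d 1≤b Q≡7^n b≡2a 7∤a
... | inj₂ a<2b with e , 1+a+e≡2b ← m≤n⇒∃[o]m+o≡n a<2b =
  next-< a b e (trans (+-suc a e) 1+a+e≡2b) Q≡7^n b≡2a 7∤a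

solution[1+_] : ∀ n → Solution (suc n)
solution[1+ zero  ] = solution[1]
solution[1+ suc n ] = next solution[1+ n ]

claim1 : (n : ℕ) → 1 ≤ n →
    ∃[ a ] ∃[ b ] (1 ≤ a × 1 ≤ b × a * a + b * b + a * b ≡ 7 ^ n × gcd a 7 ≡ 1)
claim1 (suc n) _ = a , b , ∤⇒positive 7∤a , 1≤b , Q≡7^n , coprime⇒gcd≡1 (∤⇒coprime prime[7] 7∤a)
  where open Solution solution[1+ n ]
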